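{- Let $(\mathcal{C},\otimes,I)$ be a symmetric monoidal category with finite products, equipped with a reciprocal orthogonality relative to an object $J$, and let $\mathbf{A}=(A,\mathbf{A}_p)$ be an object of $T_J(\mathcal{C})$ such that for each $n\in\mathbb{N}$ the $n!$ symmetries of $A_\bullet^{\otimes n}$ have an equaliser $\mathsf{eq}_A:A^{\le n}\to A_\bullet^{\otimes n}$ in $\mathcal{C}$. Then $\mathbf{A}^{\le n}=(A^{\le n},(\mathbf{A}^{\le n})_p)$ with $\mathsf{eq}_A$ is an equaliser in $T_J(\mathcal{C})$ of the $n!$ symmetries of $(\mathbf{A}\&\mathbf{I})^{\otimes n}$.
   Context: $A_\bullet=A\& I$. A reciprocal orthogonality relative to $J$ is a family of relations $\perp_R\subseteq\mathcal{C}(I,R)\times\mathcal{C}(R,J)$ with $u\perp_R x\circ f$ iff $f\circ u\perp_S x$ for all $u:I\to R$, $f:R\to S$, $x:S\to J$. Orthogonals: $U^\circ=\{x:\forall u\in U,\ u\perp x\}$ for $U\subseteq\mathcal{C}(I,R)$ and $X^\circ=\{u:\forall x\in X,\ u\perp x\}$ for $X\subseteq\mathcal{C}(R,J)$. For $u:I\to R$, $v:I\to S$, $u\otimes v$ is $I\cong I\otimes I\to R\otimes S$, and $U\otimes V=\{u\otimes v\}$. $T_J(\mathcal{C})$: objects $(A,\mathbf{A}_p)$ with $\mathbf{A}_p\subseteq\mathcal{C}(I,A)$, $\mathbf{A}_p^{\circ\circ}=\mathbf{A}_p$; morphisms $\mathbf{A}\to\mathbf{B}$ are $f\in\mathcal{C}(A,B)$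 with $f\circ u\in\mathbf{B}_p$ for all $u\in\mathbf{A}_p$; products $\mathbf{A}\&\mathbf{B}=(A\& B,\{\langle u,v\rangle:u\in\mathbf{A}_p,v\in\mathbf{B}_p\})$; tensor $\mathbf{A}\otimes\mathbf{B}=(A\otimes B,(\mathbf{A}_p\otimes\mathbf{B}_p)^{\circ\circ})$; unit $\mathbf{I}=(I,\{\mathrm{id}_I\}^{\circ\circ})$. For $h:X\to A_\bullet^{\otimes n}$ equalising all symmetries, $\mathsf{eq}_A\backslash h$ is the unique morphism with $\mathsf{eq}_A\circ(\mathsf{eq}_A\backslash h)=h$. Define $(\mathbf{A}^{\le n})_p=\{\mathsf{eq}_A\backslash h:h\in((\mathbf{A}\&\mathbf{I})^{\otimes n})_p,\ h\text{ equalises all symmetries of }A_\bullet^{\otimes n}\}^{\circ\circ}$ (with $I\cong I^{\otimes n}$). -}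

module Defs where

open import Level using (Level; _⊔_) renaming (suc to lsuc)
open import Data.Nat using (ℕ; zero; suc)
open import Data.Product using (Σ; _×_; _,_; Σ-syntax)
open import Relation.Unary using (Pred)
open import Relation.Binary.PropositionalEquality using (_≡_)

record SymMonCatFP (o ℓ : Level) : Set (lsuc (o ⊔ ℓ)) where
  infixr 9 _∘_
  infixr 10 _⊗₀_ _⊗₁_
  field
    Obj : Set o
    Hom : Obj → Obj → Set ℓ
    id  : ∀ {A} → Hom A A
    _∘_ : ∀ {A B C} → Hom B C → Hom A B → Hom A C
    identityˡ : ∀ {A B} {f : Hom A B} → id ∘ f ≡ f
    identityʳ : ∀ {A B} {f : Hom A B} → f ∘ id ≡ f
    assoc : ∀ {A B C D} {f : Hom A B} {g : Hom B C} {h : Hom C D} →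
            (h ∘ g) ∘ f ≡ h ∘ (g ∘ f)
    _⊗₀_ : Obj → Obj → Obj
    _⊗₁_ : ∀ {A B C D} → Hom A B → Hom C D → Hom (A ⊗₀ C) (B ⊗₀ D)
    ⊗-id : ∀ {A B} → id {A} ⊗₁ id {B} ≡ id
    ⊗-∘  : ∀ {A B C D E F} {f : Hom B C} {g : Hom A B} {h : Hom E F} {k : Hom D E} →
           (f ∘ g) ⊗₁ (h ∘ k) ≡ (f ⊗₁ h) ∘ (g ⊗₁ k)
    I : Obj
    λ⇒ : ∀ {A} → Hom (I ⊗₀ A) A
    λ⇐ : ∀ {A} → Hom A (I ⊗₀ A)
    λ-iso₁ : ∀ {A} → λ⇒ {A} ∘ λ⇐ ≡ id
    λ-iso₂ : ∀ {A} → λ⇐ {A} ∘ λ⇒ ≡ id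
    λ-nat : ∀ {A B} {f : Hom A B} → f ∘ λ⇒ ≡ λ⇒ ∘ (id ⊗₁ f)
    ρ⇒ : ∀ {A} → Hom (A ⊗₀ I) A
    ρ⇐ : ∀ {A} → Hom A (A ⊗₀ I)
    ρ-iso₁ : ∀ {A} → ρ⇒ {A} ∘ ρ⇐ ≡ id
    ρ-iso₂ : ∀ {A} → ρ⇐ {A} ∘ ρ⇒ ≡ id
    ρ-nat : ∀ {A B} {f : Hom A B} → f ∘ ρ⇒ ≡ ρ⇒ ∘ (f ⊗₁ id)
    α⇒ : ∀ {A B C} → Hom ((A ⊗₀ B) ⊗₀ C) (A ⊗₀ (B ⊗₀ C))
    α⇐ : ∀ {A B C} → Hom (A ⊗₀ (B ⊗₀ C)) ((A ⊗₀ B) ⊗₀ C)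
    α-iso₁ : ∀ {A B C} → α⇒ {A} {B} {C} ∘ α⇐ ≡ id
    α-iso₂ : ∀ {A B C} → α⇐ {A} {B} {C} ∘ α⇒ ≡ id
    α-nat : ∀ {A A' B B' C C'} {f : Hom A A'} {g : Hom B B'} {h : Hom C C'} →
            (f ⊗₁ (g ⊗₁ h)) ∘ α⇒ ≡ α⇒ ∘ ((f ⊗₁ g) ⊗₁ h)
    triangle : ∀ {A B} → (id {A} ⊗₁ λ⇒ {B}) ∘ α⇒ ≡ ρ⇒ ⊗₁ id
    pentagon : ∀ {A B C D} →
               (id {A} ⊗₁ α⇒ {B} {C} {D}) ∘ (α⇒ ∘ (α⇒ ⊗₁ id)) ≡ α⇒ ∘ α⇒
    σ : ∀ {A B} → Hom (A ⊗₀ B) (B ⊗₀ A)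
    σ-nat : ∀ {A A' B B'} {f : Hom A A'} {g : Hom B B'} →
            (g ⊗₁ f) ∘ σ ≡ σ ∘ (f ⊗₁ g)
    σ-inv : ∀ {A B} → σ {B} {A} ∘ σ {A} {B} ≡ id
    hexagon : ∀ {A B C} →
              (id {B} ⊗₁ σ {A} {C}) ∘ (α⇒ ∘ (σ ⊗₁ id)) ≡ α⇒ ∘ (σ ∘ α⇒)
    ⊤ : Obj
    ! : ∀ {A} → Hom A ⊤
    !-unique : ∀ {A} (f : Hom A ⊤) → f ≡ !
    _&_ : Obj → Obj → Obj
    π₁ : ∀ {A B} → Hom (A & B) A
    π₂ : ∀ {A B} → Hom (A & B) B
    ⟨_,_⟩ : ∀ {X A B} → Hom X A → Hom X B → Hom X (A & B)
    π₁-β : ∀ {X A B} {f : Hom X A} {g : Hom X B} → π₁ ∘ ⟨ f , g ⟩ ≡ f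
    π₂-β : ∀ {X A B} {f : Hom X A} {g : Hom X B} → π₂ ∘ ⟨ f , g ⟩ ≡ g
    ⟨⟩-unique : ∀ {X A B} {f : Hom X A} {g : Hom X B} (h : Hom X (A & B)) →
                π₁ ∘ h ≡ f → π₂ ∘ h ≡ g → h ≡ ⟨ f , g ⟩

module _ {o ℓ : Level} (𝒞 : SymMonCatFP o ℓ) where
  open SymMonCatFP 𝒞

  record ReciprocalOrthogonality (J : Obj) : Set (lsuc (o ⊔ ℓ)) where
    field
      _⊥_ : ∀ {R} → Hom I R → Hom R J → Set ℓ
      recip⇒ : ∀ {R S} (u : Hom I R) (f : Hom R S) (x : Hom S J) →
               u ⊥ (x ∘ f) → (f ∘ u) ⊥ x
      recip⇐ : ∀ {R S} (u : Hom I R) (f : Hom R S) (x : Hom S J) →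
               (f ∘ u) ⊥ x → u ⊥ (x ∘ f)

  _^⊗_ : Obj → ℕ → Obj
  B ^⊗ zero = I
  B ^⊗ suc n = B ⊗₀ (B ^⊗ n)

  data AdjSwap (B : Obj) : (n : ℕ) → Hom (B ^⊗ n) (B ^⊗ n) → Set ℓ where
    here  : ∀ m → AdjSwap B (suc (suc m)) (α⇒ ∘ ((σ ⊗₁ id) ∘ α⇐))
    there : ∀ {n f} → AdjSwap B n f → AdjSwap B (suc n) (id ⊗₁ f)

  -- the symmetries of B^{⊗n}: composites of adjacent transpositions
  -- (i.e. the image of the symmetric group S_n)
  data Symmetry (B : Obj) (n : ℕ) : Hom (B ^⊗ n) (B ^⊗ n) → Set ℓ where
    sym-id   : Symmetry B n id
    sym-step : ∀ {s f} → AdjSwap B n s → Symmetry B n f → Symmetry B n (s ∘ f)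

  EqualisesSyms : (B : Obj) (n : ℕ) {X : Obj} → Hom X (B ^⊗ n) → Set ℓ
  EqualisesSyms B n h = ∀ s → Symmetry B n s → s ∘ h ≡ h

  record SymEqualiser (B : Obj) (n : ℕ) : Set (o ⊔ ℓ) where
    field
      obj : Obj
      arr : Hom obj (B ^⊗ n)
      equalises : EqualisesSyms B n arr
      factor : ∀ {X} (h : Hom X (B ^⊗ n)) → EqualisesSyms B n h → Hom X obj
      factor-eq : ∀ {X} (h : Hom X (B ^⊗ n)) (e : EqualisesSyms B n h) →
                  arr ∘ factor h e ≡ h
      factor-unique : ∀ {X} (h : Hom X (B ^⊗ n)) (e : EqualisesSyms B n h)
                      (k : Hom X obj) → arr ∘ k ≡ h → k ≡ factor h e

  module _ {J : Obj} (O : ReciprocalOrthogonality J) where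
    open ReciprocalOrthogonality O

    Points : Obj → Set (lsuc ℓ)
    Points R = Pred (Hom I R) ℓ

    orth : ∀ {R} → Points R → Pred (Hom R J) ℓ
    orth U x = ∀ u → U u → u ⊥ x

    orthᵒ : ∀ {R} → Pred (Hom R J) ℓ → Points R
    orthᵒ X u = ∀ x → X x → u ⊥ x

    biorth : ∀ {R} → Points R → Points R
    biorth U = orthᵒ (orth U)

    Closed : ∀ {R} → Points R → Set ℓ
    Closed U = (∀ u → biorth U u → U u) × (∀ u → U u → biorth U u)

    IsTHom : ∀ {R S} → Points R → Points S → Hom R S → Set ℓ
    IsTHom U V f = ∀ u → U u → V (f ∘ u)

    _⊗pt_ : ∀ {R S} → Hom I R → Hom I S → Hom I (R ⊗₀ S)
    u ⊗pt v = (u ⊗₁ v) ∘ λ⇐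

    _&P_ : ∀ {R S} → Points R → Points S → Points (R & S)
    (U &P V) w = Σ[ u ∈ Hom I _ ] Σ[ v ∈ Hom I _ ] (U u × V v × w ≡ ⟨ u , v ⟩)

    _⊗P_ : ∀ {R S} → Points R → Points S → Points (R ⊗₀ S)
    U ⊗P V = biorth (λ w → Σ[ u ∈ Hom I _ ] Σ[ v ∈ Hom I _ ] (U u × V v × w ≡ u ⊗pt v))

    unitP : Points I
    unitP = biorth (λ u → u ≡ id)

    powP : ∀ {B} → Points B → (n : ℕ) → Points (B ^⊗ n)
    powP U zero = unitP
    powP U (suc n) = U ⊗P powP U n

    leqP : ∀ {A} (Ap : Points A) (n : ℕ) (E : SymEqualiser (A & I) n) →
           Points (SymEqualiser.obj E)
    leqP {A} Ap n E = biorth (λ k → Σ[ h ∈ Hom I ((A & I) ^⊗ n) ]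
                         Σ[ e ∈ EqualisesSyms (A & I) n h ]
                           (powP (Ap &P unitP) n h × k ≡ SymEqualiser.factor E h e))

    IsTEqualiser : (B : Obj) (n : ℕ) (Dp : Points (B ^⊗ n))
                   (E : Obj) (Ep : Points E) (eq : Hom E (B ^⊗ n)) → Set (o ⊔ lsuc ℓ)
    IsTEqualiser B n Dp E Ep eq =
      Closed Ep
      × IsTHom Ep Dp eq
      × (∀ s → Symmetry B n s → IsTHom Dp Dp s)
      × EqualisesSyms B n eq
      × (∀ (X : Obj) (Xp : Points X) → Closed Xp →
           (h : Hom X (B ^⊗ n)) → IsTHom Xp Dp h → EqualisesSyms B n h →
           Σ[ k ∈ Hom X E ] (IsTHom Xp Ep k × eq ∘ k ≡ h ×
             (∀ (k' : Hom X E) → IsTHom Xp Ep k' → eq ∘ k' ≡ h → k' ≡ k)))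

{-# OPTIONS --safe #-}
-- The points of a tensor power (𝐁^{⊗n})_p are the biorthogonal of the
-- pure tensors u₁ ⊗ … ⊗ uₙ, and a map sends a biorthogonal into a closed
-- set as soon as it does so on generators (this is where reciprocity is
-- used).  An adjacent transposition sends u ⊗ (v ⊗ t) to v ⊗ (u ⊗ t),
-- because the symmetry σ_{I,I} is the identity; hence every symmetry is a
-- morphism of T_J(𝒞).  Taking for (𝐀^{≤n})_p the biorthogonal of the
-- factorisations of symmetric points through eq_A makes eq_A a morphism,
-- and the factorisation of a symmetric T-morphism h through eq_A is again
-- a T-morphism because it sends each point x to the factorisation of h ∘ x.
module Submission where

open import Level using (Level)
open import Data.Nat using (ℕ; zero; suc)
open import Data.Product using (Σ; _×_; _,_; proj₁; proj₂)
open import Relation.Binary.PropositionalEquality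
  using (_≡_; refl; sym; trans; cong; cong₂; subst; module ≡-Reasoning)
open import Defs

module MonoidalCoherence {o ℓ : Level} (𝒞 : SymMonCatFP o ℓ) where
  open SymMonCatFP 𝒞
  open ≡-Reasoning

  cancelʳ : ∀ {X Y Z} {a : Hom X Y} {b : Hom Y X} {f g : Hom Y Z} →
            a ∘ b ≡ id → f ∘ a ≡ g ∘ a → f ≡ g
  cancelʳ {a = a} {b} {f} {g} ab p = begin
    f               ≡⟨ sym identityʳ ⟩
    f ∘ id          ≡⟨ cong (f ∘_) (sym ab) ⟩
    f ∘ (a ∘ b)     ≡⟨ sym assoc ⟩
    (f ∘ a) ∘ b     ≡⟨ cong (_∘ b) p ⟩
    (g ∘ a) ∘ b     ≡⟨ assoc ⟩
    g ∘ (a ∘ b)     ≡⟨ cong (g ∘_) ab ⟩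
    g ∘ id          ≡⟨ identityʳ ⟩
    g               ∎

  cancelˡ : ∀ {X Y Z} {a : Hom Y Z} {b : Hom Z Y} {f g : Hom X Y} →
            b ∘ a ≡ id → a ∘ f ≡ a ∘ g → f ≡ g
  cancelˡ {a = a} {b} {f} {g} ba p = begin
    f               ≡⟨ sym identityˡ ⟩
    id ∘ f          ≡⟨ cong (_∘ f) (sym ba) ⟩
    (b ∘ a) ∘ f     ≡⟨ assoc ⟩
    b ∘ (a ∘ f)     ≡⟨ cong (b ∘_) p ⟩
    b ∘ (a ∘ g)     ≡⟨ sym assoc ⟩
    (b ∘ a) ∘ g     ≡⟨ cong (_∘ g) ba ⟩
    id ∘ g          ≡⟨ identityˡ ⟩
    g               ∎

  cancelInner : ∀ {X Y Z W} {f : Hom Y W} {a : Hom Z Y} {b : Hom Y Z} {g : Hom X Y} →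
                a ∘ b ≡ id → (f ∘ a) ∘ (b ∘ g) ≡ f ∘ g
  cancelInner {f = f} {a} {b} {g} ab = begin
    (f ∘ a) ∘ (b ∘ g)   ≡⟨ assoc ⟩
    f ∘ (a ∘ (b ∘ g))   ≡⟨ cong (f ∘_) (sym assoc) ⟩
    f ∘ ((a ∘ b) ∘ g)   ≡⟨ cong (λ z → f ∘ (z ∘ g)) ab ⟩
    f ∘ (id ∘ g)        ≡⟨ cong (f ∘_) identityˡ ⟩
    f ∘ g               ∎

  elimʳ : ∀ {X Y Z} {f : Hom Y Z} {a : Hom X Y} {b : Hom Y X} → a ∘ b ≡ id → f ∘ (a ∘ b) ≡ f
  elimʳ {f = f} ab = trans (cong (f ∘_) ab) identityʳ

  ⊗-inverse : ∀ {A B C D} {a : Hom A B} {a' : Hom B A} {c : Hom C D} {c' : Hom D C} →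
              a ∘ a' ≡ id → c ∘ c' ≡ id → (a ⊗₁ c) ∘ (a' ⊗₁ c') ≡ id
  ⊗-inverse p q = trans (sym ⊗-∘) (trans (cong₂ _⊗₁_ p q) ⊗-id)

  ⊗-splitʳ : ∀ {A B C D E} {a : Hom A B} {b : Hom D E} {c : Hom C D} →
             a ⊗₁ (b ∘ c) ≡ (a ⊗₁ b) ∘ (id ⊗₁ c)
  ⊗-splitʳ = trans (cong (_⊗₁ _) (sym identityʳ)) ⊗-∘

  id⊗-injective : ∀ {A B} {f g : Hom A B} → id {I} ⊗₁ f ≡ id ⊗₁ g → f ≡ g
  id⊗-injective p = cancelʳ λ-iso₁ (trans λ-nat (trans (cong (λ⇒ ∘_) p) (sym λ-nat)))

  ⊗id-injective : ∀ {A B} {f g : Hom A B} → f ⊗₁ id {I} ≡ g ⊗₁ id → f ≡ g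
  ⊗id-injective p = cancelʳ ρ-iso₁ (trans ρ-nat (trans (cong (ρ⇒ ∘_) p) (sym ρ-nat)))

  λ⇐-nat : ∀ {A B} {f : Hom A B} → λ⇐ ∘ f ≡ (id ⊗₁ f) ∘ λ⇐
  λ⇐-nat {f = f} = begin
    λ⇐ ∘ f                              ≡⟨ sym (elimʳ λ-iso₁) ⟩
    (λ⇐ ∘ f) ∘ (λ⇒ ∘ λ⇐)                ≡⟨ sym assoc ⟩
    ((λ⇐ ∘ f) ∘ λ⇒) ∘ λ⇐                ≡⟨ cong (_∘ λ⇐) assoc ⟩
    (λ⇐ ∘ (f ∘ λ⇒)) ∘ λ⇐                ≡⟨ cong (λ z → (λ⇐ ∘ z) ∘ λ⇐) λ-nat ⟩
    (λ⇐ ∘ (λ⇒ ∘ (id ⊗₁ f))) ∘ λ⇐        ≡⟨ cong (_∘ λ⇐) (sym assoc) ⟩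
    ((λ⇐ ∘ λ⇒) ∘ (id ⊗₁ f)) ∘ λ⇐        ≡⟨ cong (λ z → (z ∘ (id ⊗₁ f)) ∘ λ⇐) λ-iso₂ ⟩
    (id ∘ (id ⊗₁ f)) ∘ λ⇐               ≡⟨ cong (_∘ λ⇐) identityˡ ⟩
    (id ⊗₁ f) ∘ λ⇐                      ∎

  α⇐-nat : ∀ {A A' B B' C C'} {f : Hom A A'} {g : Hom B B'} {h : Hom C C'} →
           α⇐ ∘ (f ⊗₁ (g ⊗₁ h)) ≡ ((f ⊗₁ g) ⊗₁ h) ∘ α⇐
  α⇐-nat {f = f} {g} {h} = begin
    α⇐ ∘ (f ⊗₁ (g ⊗₁ h))                        ≡⟨ sym (elimʳ α-iso₁) ⟩
    (α⇐ ∘ (f ⊗₁ (g ⊗₁ h))) ∘ (α⇒ ∘ α⇐)          ≡⟨ sym assoc ⟩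
    ((α⇐ ∘ (f ⊗₁ (g ⊗₁ h))) ∘ α⇒) ∘ α⇐          ≡⟨ cong (_∘ α⇐) assoc ⟩
    (α⇐ ∘ ((f ⊗₁ (g ⊗₁ h)) ∘ α⇒)) ∘ α⇐          ≡⟨ cong (λ z → (α⇐ ∘ z) ∘ α⇐) α-nat ⟩
    (α⇐ ∘ (α⇒ ∘ ((f ⊗₁ g) ⊗₁ h))) ∘ α⇐          ≡⟨ cong (_∘ α⇐) (sym assoc) ⟩
    ((α⇐ ∘ α⇒) ∘ ((f ⊗₁ g) ⊗₁ h)) ∘ α⇐          ≡⟨ cong (λ z → (z ∘ _) ∘ α⇐) α-iso₂ ⟩
    (id ∘ ((f ⊗₁ g) ⊗₁ h)) ∘ α⇐                 ≡⟨ cong (_∘ α⇐) identityˡ ⟩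
    ((f ⊗₁ g) ⊗₁ h) ∘ α⇐                        ∎

  -- Kelly's lemma: both sides agree after I ⊗ −, by pentagon and triangle.
  λ⇒∘α⇒ : ∀ {A B} → λ⇒ {A ⊗₀ B} ∘ α⇒ {I} {A} {B} ≡ λ⇒ ⊗₁ id
  λ⇒∘α⇒ {A} {B} = id⊗-injective (cancelʳ P-inverse (trans lhs (sym rhs)))
    where
    P : Hom (((I ⊗₀ I) ⊗₀ A) ⊗₀ B) (I ⊗₀ ((I ⊗₀ A) ⊗₀ B))
    P = α⇒ ∘ (α⇒ ⊗₁ id)
    P-inverse : P ∘ ((α⇐ ⊗₁ id) ∘ α⇐) ≡ id
    P-inverse = trans (cancelInner (⊗-inverse α-iso₁ identityˡ)) α-iso₁
    lhs : (id ⊗₁ (λ⇒ ∘ α⇒)) ∘ P ≡ α⇒ ∘ ((ρ⇒ ⊗₁ id) ⊗₁ id)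
    lhs = begin
      (id ⊗₁ (λ⇒ ∘ α⇒)) ∘ P
        ≡⟨ cong (_∘ P) (trans (cong (_⊗₁ (λ⇒ ∘ α⇒)) (sym identityˡ)) ⊗-∘) ⟩
      ((id ⊗₁ λ⇒) ∘ (id ⊗₁ α⇒)) ∘ P                    ≡⟨ assoc ⟩
      (id ⊗₁ λ⇒) ∘ ((id ⊗₁ α⇒) ∘ (α⇒ ∘ (α⇒ ⊗₁ id)))    ≡⟨ cong ((id ⊗₁ λ⇒) ∘_) pentagon ⟩
      (id ⊗₁ λ⇒) ∘ (α⇒ ∘ α⇒)                           ≡⟨ sym assoc ⟩
      ((id ⊗₁ λ⇒) ∘ α⇒) ∘ α⇒                           ≡⟨ cong (_∘ α⇒) triangle ⟩
      (ρ⇒ ⊗₁ id) ∘ α⇒                                  ≡⟨ cong (λ z → (ρ⇒ ⊗₁ z) ∘ α⇒) (sym ⊗-id) ⟩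
      (ρ⇒ ⊗₁ (id ⊗₁ id)) ∘ α⇒                          ≡⟨ α-nat ⟩
      α⇒ ∘ ((ρ⇒ ⊗₁ id) ⊗₁ id)                          ∎
    rhs : (id ⊗₁ (λ⇒ ⊗₁ id)) ∘ P ≡ α⇒ ∘ ((ρ⇒ ⊗₁ id) ⊗₁ id)
    rhs = begin
      (id ⊗₁ (λ⇒ ⊗₁ id)) ∘ (α⇒ ∘ (α⇒ ⊗₁ id))   ≡⟨ sym assoc ⟩
      ((id ⊗₁ (λ⇒ ⊗₁ id)) ∘ α⇒) ∘ (α⇒ ⊗₁ id)   ≡⟨ cong (_∘ (α⇒ ⊗₁ id)) α-nat ⟩
      (α⇒ ∘ ((id ⊗₁ λ⇒) ⊗₁ id)) ∘ (α⇒ ⊗₁ id)   ≡⟨ assoc ⟩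
      α⇒ ∘ (((id ⊗₁ λ⇒) ⊗₁ id) ∘ (α⇒ ⊗₁ id))   ≡⟨ cong (α⇒ ∘_) (sym ⊗-∘) ⟩
      α⇒ ∘ (((id ⊗₁ λ⇒) ∘ α⇒) ⊗₁ (id ∘ id))    ≡⟨ cong₂ (λ a b → α⇒ ∘ (a ⊗₁ b)) triangle identityˡ ⟩
      α⇒ ∘ ((ρ⇒ ⊗₁ id) ⊗₁ id)                  ∎

  λ⇒≡ρ⇒ : λ⇒ {I} ≡ ρ⇒ {I}
  λ⇒≡ρ⇒ = ⊗id-injective (begin
    λ⇒ ⊗₁ id          ≡⟨ sym λ⇒∘α⇒ ⟩
    λ⇒ ∘ α⇒           ≡⟨ cong (_∘ α⇒) (cancelˡ λ-iso₂ λ-nat) ⟩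
    (id ⊗₁ λ⇒) ∘ α⇒   ≡⟨ triangle ⟩
    ρ⇒ ⊗₁ id          ∎)

  λ⇐≡ρ⇐ : λ⇐ {I} ≡ ρ⇐ {I}
  λ⇐≡ρ⇐ = begin
    λ⇐                 ≡⟨ sym (elimʳ ρ-iso₁) ⟩
    λ⇐ ∘ (ρ⇒ ∘ ρ⇐)     ≡⟨ cong (λ z → λ⇐ ∘ (z ∘ ρ⇐)) (sym λ⇒≡ρ⇒) ⟩
    λ⇐ ∘ (λ⇒ ∘ ρ⇐)     ≡⟨ sym assoc ⟩
    (λ⇐ ∘ λ⇒) ∘ ρ⇐     ≡⟨ cong (_∘ ρ⇐) λ-iso₂ ⟩
    id ∘ ρ⇐            ≡⟨ identityˡ ⟩
    ρ⇐                 ∎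

  ⊗id≡ρ-conjugate : ∀ {A B} {g : Hom A B} → g ⊗₁ id ≡ ρ⇐ ∘ (g ∘ ρ⇒)
  ⊗id≡ρ-conjugate {g = g} = begin
    g ⊗₁ id                  ≡⟨ sym identityˡ ⟩
    id ∘ (g ⊗₁ id)           ≡⟨ cong (_∘ (g ⊗₁ id)) (sym ρ-iso₂) ⟩
    (ρ⇐ ∘ ρ⇒) ∘ (g ⊗₁ id)    ≡⟨ assoc ⟩
    ρ⇐ ∘ (ρ⇒ ∘ (g ⊗₁ id))    ≡⟨ cong (ρ⇐ ∘_) (sym ρ-nat) ⟩
    ρ⇐ ∘ (g ∘ ρ⇒)            ∎

  id⊗≡λ-conjugate : ∀ {A B} {g : Hom A B} → id ⊗₁ g ≡ λ⇐ ∘ (g ∘ λ⇒)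
  id⊗≡λ-conjugate {g = g} = begin
    id ⊗₁ g                  ≡⟨ sym identityˡ ⟩
    id ∘ (id ⊗₁ g)           ≡⟨ cong (_∘ (id ⊗₁ g)) (sym λ-iso₂) ⟩
    (λ⇐ ∘ λ⇒) ∘ (id ⊗₁ g)    ≡⟨ assoc ⟩
    λ⇐ ∘ (λ⇒ ∘ (id ⊗₁ g))    ≡⟨ cong (λ⇐ ∘_) (sym λ-nat) ⟩
    λ⇐ ∘ (g ∘ λ⇒)            ∎

  scalar-id⊗≡⊗id : {g : Hom I I} → id ⊗₁ g ≡ g ⊗₁ id
  scalar-id⊗≡⊗id {g} =
    trans id⊗≡λ-conjugate
      (trans (cong₂ (λ a b → a ∘ (g ∘ b)) λ⇐≡ρ⇐ λ⇒≡ρ⇒) (sym ⊗id≡ρ-conjugate))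

  I⊗I-endo≡scalar⊗id : {f : Hom (I ⊗₀ I) (I ⊗₀ I)} → (ρ⇒ ∘ (f ∘ ρ⇐)) ⊗₁ id ≡ f
  I⊗I-endo≡scalar⊗id {f} = begin
    (ρ⇒ ∘ (f ∘ ρ⇐)) ⊗₁ id                  ≡⟨ ⊗id≡ρ-conjugate ⟩
    ρ⇐ ∘ ((ρ⇒ ∘ (f ∘ ρ⇐)) ∘ ρ⇒)            ≡⟨ sym assoc ⟩
    (ρ⇐ ∘ (ρ⇒ ∘ (f ∘ ρ⇐))) ∘ ρ⇒            ≡⟨ cong (_∘ ρ⇒) (sym assoc) ⟩
    ((ρ⇐ ∘ ρ⇒) ∘ (f ∘ ρ⇐)) ∘ ρ⇒            ≡⟨ cong (λ z → (z ∘ (f ∘ ρ⇐)) ∘ ρ⇒) ρ-iso₂ ⟩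
    (id ∘ (f ∘ ρ⇐)) ∘ ρ⇒                   ≡⟨ cong (_∘ ρ⇒) identityˡ ⟩
    (f ∘ ρ⇐) ∘ ρ⇒                          ≡⟨ assoc ⟩
    f ∘ (ρ⇐ ∘ ρ⇒)                          ≡⟨ elimʳ ρ-iso₂ ⟩
    f                                      ∎

  α⇒∘ρ⇐⊗id : ∀ {X} → α⇒ {I} {I} {X} ∘ (ρ⇐ ⊗₁ id) ≡ id ⊗₁ λ⇐
  α⇒∘ρ⇐⊗id = sym (begin
    id ⊗₁ λ⇐
      ≡⟨ sym (elimʳ (⊗-inverse ρ-iso₁ identityˡ)) ⟩
    (id ⊗₁ λ⇐) ∘ ((ρ⇒ ⊗₁ id) ∘ (ρ⇐ ⊗₁ id))
      ≡⟨ cong (λ z → (id ⊗₁ λ⇐) ∘ (z ∘ (ρ⇐ ⊗₁ id))) (sym triangle) ⟩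
    (id ⊗₁ λ⇐) ∘ (((id ⊗₁ λ⇒) ∘ α⇒) ∘ (ρ⇐ ⊗₁ id))
      ≡⟨ cong ((id ⊗₁ λ⇐) ∘_) assoc ⟩
    (id ⊗₁ λ⇐) ∘ ((id ⊗₁ λ⇒) ∘ (α⇒ ∘ (ρ⇐ ⊗₁ id)))
      ≡⟨ sym assoc ⟩
    ((id ⊗₁ λ⇐) ∘ (id ⊗₁ λ⇒)) ∘ (α⇒ ∘ (ρ⇐ ⊗₁ id))
      ≡⟨ cong (_∘ (α⇒ ∘ (ρ⇐ ⊗₁ id))) (⊗-inverse identityˡ λ-iso₂) ⟩
    id ∘ (α⇒ ∘ (ρ⇐ ⊗₁ id))
      ≡⟨ identityˡ ⟩
    α⇒ ∘ (ρ⇐ ⊗₁ id) ∎)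

  -- σ_{I,I} is (ρ ∘ σ ∘ ρ⁻¹) ⊗ id; the hexagon at (I, I, I) shows that this
  -- scalar acts on I ⊗ (I ⊗ I) as its own square, hence trivially.
  σ-scalar : Hom I I
  σ-scalar = ρ⇒ ∘ (σ ∘ ρ⇐)

  σ-I⊗I : σ {I} {I ⊗₀ I} ≡ (ρ⇐ ⊗₁ id) ∘ (σ ∘ (id ⊗₁ ρ⇒))
  σ-I⊗I = begin
    σ                                      ≡⟨ sym (elimʳ (⊗-inverse identityˡ ρ-iso₂)) ⟩
    σ ∘ ((id ⊗₁ ρ⇐) ∘ (id ⊗₁ ρ⇒))          ≡⟨ sym assoc ⟩
    (σ ∘ (id ⊗₁ ρ⇐)) ∘ (id ⊗₁ ρ⇒)          ≡⟨ cong (_∘ (id ⊗₁ ρ⇒)) (sym σ-nat) ⟩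
    ((ρ⇐ ⊗₁ id) ∘ σ) ∘ (id ⊗₁ ρ⇒)          ≡⟨ assoc ⟩
    (ρ⇐ ⊗₁ id) ∘ (σ ∘ (id ⊗₁ ρ⇒))          ∎

  hexagon-lhs-I : (id ⊗₁ σ) ∘ (α⇒ ∘ (σ ⊗₁ id)) ≡ (σ-scalar ⊗₁ σ {I} {I}) ∘ α⇒
  hexagon-lhs-I = begin
    (id ⊗₁ σ) ∘ (α⇒ ∘ (σ ⊗₁ id))
      ≡⟨ cong (λ z → (id ⊗₁ σ) ∘ (α⇒ ∘ (z ⊗₁ id))) (sym I⊗I-endo≡scalar⊗id) ⟩
    (id ⊗₁ σ) ∘ (α⇒ ∘ ((σ-scalar ⊗₁ id) ⊗₁ id))
      ≡⟨ cong ((id ⊗₁ σ) ∘_) (sym α-nat) ⟩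
    (id ⊗₁ σ) ∘ ((σ-scalar ⊗₁ (id ⊗₁ id)) ∘ α⇒)
      ≡⟨ cong (λ z → (id ⊗₁ σ) ∘ ((σ-scalar ⊗₁ z) ∘ α⇒)) ⊗-id ⟩
    (id ⊗₁ σ) ∘ ((σ-scalar ⊗₁ id) ∘ α⇒)
      ≡⟨ sym assoc ⟩
    ((id ⊗₁ σ) ∘ (σ-scalar ⊗₁ id)) ∘ α⇒
      ≡⟨ cong (_∘ α⇒) (sym ⊗-∘) ⟩
    ((id ∘ σ-scalar) ⊗₁ (σ ∘ id)) ∘ α⇒
      ≡⟨ cong₂ (λ a b → (a ⊗₁ b) ∘ α⇒) identityˡ identityʳ ⟩
    (σ-scalar ⊗₁ σ) ∘ α⇒ ∎

  hexagon-rhs-I : α⇒ ∘ (σ ∘ α⇒) ≡ (id ⊗₁ σ {I} {I}) ∘ α⇒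
  hexagon-rhs-I = begin
    α⇒ ∘ (σ ∘ α⇒)
      ≡⟨ cong (λ z → α⇒ ∘ (z ∘ α⇒)) σ-I⊗I ⟩
    α⇒ ∘ (((ρ⇐ ⊗₁ id) ∘ (σ ∘ (id ⊗₁ ρ⇒))) ∘ α⇒)
      ≡⟨ cong (α⇒ ∘_) assoc ⟩
    α⇒ ∘ ((ρ⇐ ⊗₁ id) ∘ ((σ ∘ (id ⊗₁ ρ⇒)) ∘ α⇒))
      ≡⟨ sym assoc ⟩
    (α⇒ ∘ (ρ⇐ ⊗₁ id)) ∘ ((σ ∘ (id ⊗₁ ρ⇒)) ∘ α⇒)
      ≡⟨ cong₂ (λ a b → a ∘ ((b ∘ (id ⊗₁ ρ⇒)) ∘ α⇒)) α⇒∘ρ⇐⊗id σ≡id⊗σ-scalar ⟩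
    (id ⊗₁ λ⇐) ∘ (((id ⊗₁ σ-scalar) ∘ (id ⊗₁ ρ⇒)) ∘ α⇒)
      ≡⟨ cong (λ z → (id ⊗₁ λ⇐) ∘ (z ∘ α⇒)) (sym ⊗-∘) ⟩
    (id ⊗₁ λ⇐) ∘ (((id ∘ id) ⊗₁ (σ-scalar ∘ ρ⇒)) ∘ α⇒)
      ≡⟨ sym assoc ⟩
    ((id ⊗₁ λ⇐) ∘ ((id ∘ id) ⊗₁ (σ-scalar ∘ ρ⇒))) ∘ α⇒
      ≡⟨ cong (_∘ α⇒) (sym ⊗-∘) ⟩
    ((id ∘ (id ∘ id)) ⊗₁ (λ⇐ ∘ (σ-scalar ∘ ρ⇒))) ∘ α⇒
      ≡⟨ cong₂ (λ a b → (a ⊗₁ b) ∘ α⇒) (trans identityˡ identityˡ)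
               (trans (cong (_∘ (σ-scalar ∘ ρ⇒)) λ⇐≡ρ⇐) (sym ⊗id≡ρ-conjugate)) ⟩
    (id ⊗₁ (σ-scalar ⊗₁ id)) ∘ α⇒
      ≡⟨ cong (λ z → (id ⊗₁ z) ∘ α⇒) I⊗I-endo≡scalar⊗id ⟩
    (id ⊗₁ σ) ∘ α⇒ ∎
    where
    σ≡id⊗σ-scalar : σ {I} {I} ≡ id ⊗₁ σ-scalar
    σ≡id⊗σ-scalar = trans (sym I⊗I-endo≡scalar⊗id) (sym scalar-id⊗≡⊗id)

  σ-scalar⊗id≡id : σ-scalar ⊗₁ id {I ⊗₀ I} ≡ id
  σ-scalar⊗id≡id = begin
    σ-scalar ⊗₁ id                 ≡⟨ cong₂ _⊗₁_ (sym identityʳ) (sym σ-inv) ⟩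
    (σ-scalar ∘ id) ⊗₁ (σ ∘ σ)     ≡⟨ ⊗-∘ ⟩
    (σ-scalar ⊗₁ σ) ∘ (id ⊗₁ σ)    ≡⟨ cong (_∘ (id ⊗₁ σ)) σ-scalar⊗σ≡id⊗σ ⟩
    (id ⊗₁ σ) ∘ (id ⊗₁ σ)          ≡⟨ ⊗-inverse identityˡ σ-inv ⟩
    id                             ∎
    where
    σ-scalar⊗σ≡id⊗σ : σ-scalar ⊗₁ σ ≡ id ⊗₁ σ
    σ-scalar⊗σ≡id⊗σ = cancelʳ α-iso₁ (trans (sym hexagon-lhs-I) (trans hexagon hexagon-rhs-I))

  σ-I≡id : σ {I} {I} ≡ id
  σ-I≡id = begin
    σ                                                ≡⟨ sym I⊗I-endo≡scalar⊗id ⟩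
    σ-scalar ⊗₁ id                                   ≡⟨ sym (restrict σ-scalar) ⟩
    (id ⊗₁ ρ⇒) ∘ ((σ-scalar ⊗₁ id) ∘ (id ⊗₁ ρ⇐))   ≡⟨ cong (λ z → (id ⊗₁ ρ⇒) ∘ (z ∘ (id ⊗₁ ρ⇐)))
                                                              (trans σ-scalar⊗id≡id (sym ⊗-id)) ⟩
    (id ⊗₁ ρ⇒) ∘ ((id ⊗₁ id) ∘ (id ⊗₁ ρ⇐))         ≡⟨ restrict id ⟩
    id ⊗₁ id                                         ≡⟨ ⊗-id ⟩
    id                                               ∎
    where
    restrict : (g : Hom I I) → (id ⊗₁ ρ⇒ {I}) ∘ ((g ⊗₁ id {I ⊗₀ I}) ∘ (id ⊗₁ ρ⇐)) ≡ g ⊗₁ id {I}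
    restrict g = begin
      (id ⊗₁ ρ⇒) ∘ ((g ⊗₁ id) ∘ (id ⊗₁ ρ⇐))   ≡⟨ cong ((id ⊗₁ ρ⇒) ∘_) (sym ⊗-∘) ⟩
      (id ⊗₁ ρ⇒) ∘ ((g ∘ id) ⊗₁ (id ∘ ρ⇐))    ≡⟨ sym ⊗-∘ ⟩
      (id ∘ (g ∘ id)) ⊗₁ (ρ⇒ ∘ (id ∘ ρ⇐))     ≡⟨ cong₂ _⊗₁_ (trans identityˡ identityʳ)
                                                          (trans (cong (ρ⇒ ∘_) identityˡ) ρ-iso₁) ⟩
      g ⊗₁ id                                 ∎

module TensorPowerEqualiser {o ℓ : Level} (𝒞 : SymMonCatFP o ℓ) {J : SymMonCatFP.Obj 𝒞}
                            (O : ReciprocalOrthogonality 𝒞 J) where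
  open SymMonCatFP 𝒞
  open ReciprocalOrthogonality O
  open MonoidalCoherence 𝒞
  open ≡-Reasoning

  infixr 10 _⊗p_
  _⊗p_ : ∀ {R S} → Hom I R → Hom I S → Hom I (R ⊗₀ S)
  _⊗p_ = _⊗pt_ 𝒞 O

  biorth-closed : ∀ {R} (U : Points 𝒞 O R) → Closed 𝒞 O (biorth 𝒞 O U)
  biorth-closed U = (λ u u° x x° → u° x (λ v v∈U → v∈U x x°)) , (λ u u∈U x x° → x° u u∈U)

  ⊆-biorth : ∀ {R} {U : Points 𝒞 O R} {u : Hom I R} → U u → biorth 𝒞 O U u
  ⊆-biorth {u = u} u∈U x x° = x° u u∈U

  -- By reciprocity f ∘ g ⊥ y iff g ⊥ y ∘ f, so f maps G°° into (f ∘ G)°° ⊆ W°° = W.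
  biorth-IsTHom : ∀ {R S} (G : Points 𝒞 O R) (W : Points 𝒞 O S) → Closed 𝒞 O W →
                  (f : Hom R S) → (∀ g → G g → W (f ∘ g)) → IsTHom 𝒞 O (biorth 𝒞 O G) W f
  biorth-IsTHom G W W-closed f f[G]⊆W w w∈G°° =
    proj₁ W-closed (f ∘ w) λ y y∈W° →
      recip⇒ w f y (w∈G°° (y ∘ f) λ g g∈G →
        recip⇐ g f y (proj₂ W-closed (f ∘ g) (f[G]⊆W g g∈G) y y∈W°))

  tensorGenerators : ∀ {R S} → Points 𝒞 O R → Points 𝒞 O S → Points 𝒞 O (R ⊗₀ S)
  tensorGenerators P Q w = Σ (Hom I _) λ u → Σ (Hom I _) λ v → (P u × Q v × w ≡ u ⊗p v)

  tensorLeft : ∀ {B X} → Hom I B → Hom X (B ⊗₀ X)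
  tensorLeft u = (u ⊗₁ id) ∘ λ⇐

  tensorLeft-∘ : ∀ {B X} (u : Hom I B) (w : Hom I X) → tensorLeft u ∘ w ≡ u ⊗p w
  tensorLeft-∘ u w = begin
    ((u ⊗₁ id) ∘ λ⇐) ∘ w           ≡⟨ assoc ⟩
    (u ⊗₁ id) ∘ (λ⇐ ∘ w)           ≡⟨ cong ((u ⊗₁ id) ∘_) λ⇐-nat ⟩
    (u ⊗₁ id) ∘ ((id ⊗₁ w) ∘ λ⇐)   ≡⟨ sym assoc ⟩
    ((u ⊗₁ id) ∘ (id ⊗₁ w)) ∘ λ⇐   ≡⟨ cong (_∘ λ⇐) (sym ⊗-∘) ⟩
    ((u ∘ id) ⊗₁ (id ∘ w)) ∘ λ⇐    ≡⟨ cong₂ (λ a b → (a ⊗₁ b) ∘ λ⇐) identityʳ identityˡ ⟩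
    (u ⊗₁ w) ∘ λ⇐                  ∎

  id⊗-∘-⊗p : ∀ {B X Y} (f : Hom X Y) (u : Hom I B) (v : Hom I X) → (id ⊗₁ f) ∘ (u ⊗p v) ≡ u ⊗p (f ∘ v)
  id⊗-∘-⊗p f u v = begin
    (id ⊗₁ f) ∘ ((u ⊗₁ v) ∘ λ⇐)   ≡⟨ sym assoc ⟩
    ((id ⊗₁ f) ∘ (u ⊗₁ v)) ∘ λ⇐   ≡⟨ cong (_∘ λ⇐) (sym ⊗-∘) ⟩
    ((id ∘ u) ⊗₁ (f ∘ v)) ∘ λ⇐    ≡⟨ cong (λ z → (z ⊗₁ (f ∘ v)) ∘ λ⇐) identityˡ ⟩
    (u ⊗₁ (f ∘ v)) ∘ λ⇐           ∎

  swap₁₂ : ∀ {B X} → Hom (B ⊗₀ (B ⊗₀ X)) (B ⊗₀ (B ⊗₀ X))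
  swap₁₂ = α⇒ ∘ ((σ ⊗₁ id) ∘ α⇐)

  swap₁₂-nat : ∀ {B C X Y} {u v : Hom C B} {t : Hom Y X} →
               swap₁₂ ∘ (u ⊗₁ (v ⊗₁ t)) ≡ (v ⊗₁ (u ⊗₁ t)) ∘ swap₁₂
  swap₁₂-nat {u = u} {v} {t} = begin
    (α⇒ ∘ ((σ ⊗₁ id) ∘ α⇐)) ∘ (u ⊗₁ (v ⊗₁ t))      ≡⟨ assoc ⟩
    α⇒ ∘ (((σ ⊗₁ id) ∘ α⇐) ∘ (u ⊗₁ (v ⊗₁ t)))      ≡⟨ cong (α⇒ ∘_) assoc ⟩
    α⇒ ∘ ((σ ⊗₁ id) ∘ (α⇐ ∘ (u ⊗₁ (v ⊗₁ t))))      ≡⟨ cong (λ z → α⇒ ∘ ((σ ⊗₁ id) ∘ z)) α⇐-nat ⟩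
    α⇒ ∘ ((σ ⊗₁ id) ∘ (((u ⊗₁ v) ⊗₁ t) ∘ α⇐))      ≡⟨ cong (α⇒ ∘_) (sym assoc) ⟩
    α⇒ ∘ (((σ ⊗₁ id) ∘ ((u ⊗₁ v) ⊗₁ t)) ∘ α⇐)      ≡⟨ cong (λ z → α⇒ ∘ (z ∘ α⇐)) (sym ⊗-∘) ⟩
    α⇒ ∘ (((σ ∘ (u ⊗₁ v)) ⊗₁ (id ∘ t)) ∘ α⇐)
      ≡⟨ cong₂ (λ a b → α⇒ ∘ ((a ⊗₁ b) ∘ α⇐)) (sym σ-nat) (trans identityˡ (sym identityʳ)) ⟩
    α⇒ ∘ ((((v ⊗₁ u) ∘ σ) ⊗₁ (t ∘ id)) ∘ α⇐)       ≡⟨ cong (λ z → α⇒ ∘ (z ∘ α⇐)) ⊗-∘ ⟩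
    α⇒ ∘ ((((v ⊗₁ u) ⊗₁ t) ∘ (σ ⊗₁ id)) ∘ α⇐)      ≡⟨ cong (α⇒ ∘_) assoc ⟩
    α⇒ ∘ (((v ⊗₁ u) ⊗₁ t) ∘ ((σ ⊗₁ id) ∘ α⇐))      ≡⟨ sym assoc ⟩
    (α⇒ ∘ ((v ⊗₁ u) ⊗₁ t)) ∘ ((σ ⊗₁ id) ∘ α⇐)      ≡⟨ cong (_∘ ((σ ⊗₁ id) ∘ α⇐)) (sym α-nat) ⟩
    ((v ⊗₁ (u ⊗₁ t)) ∘ α⇒) ∘ ((σ ⊗₁ id) ∘ α⇐)      ≡⟨ assoc ⟩
    (v ⊗₁ (u ⊗₁ t)) ∘ (α⇒ ∘ ((σ ⊗₁ id) ∘ α⇐))      ∎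

  swap₁₂-I≡id : swap₁₂ {I} {I} ≡ id
  swap₁₂-I≡id = begin
    α⇒ ∘ ((σ ⊗₁ id) ∘ α⇐)     ≡⟨ cong (λ z → α⇒ ∘ ((z ⊗₁ id) ∘ α⇐)) σ-I≡id ⟩
    α⇒ ∘ ((id ⊗₁ id) ∘ α⇐)    ≡⟨ cong (λ z → α⇒ ∘ (z ∘ α⇐)) ⊗-id ⟩
    α⇒ ∘ (id ∘ α⇐)            ≡⟨ cong (α⇒ ∘_) identityˡ ⟩
    α⇒ ∘ α⇐                   ≡⟨ α-iso₁ ⟩
    id                        ∎

  swap₁₂-⊗p : ∀ {B X} (u v : Hom I B) (t : Hom I X) → swap₁₂ ∘ (u ⊗p (v ⊗p t)) ≡ v ⊗p (u ⊗p t)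
  swap₁₂-⊗p u v t = begin
    swap₁₂ ∘ ((u ⊗₁ ((v ⊗₁ t) ∘ λ⇐)) ∘ λ⇐)              ≡⟨ cong (λ z → swap₁₂ ∘ (z ∘ λ⇐)) ⊗-splitʳ ⟩
    swap₁₂ ∘ (((u ⊗₁ (v ⊗₁ t)) ∘ (id ⊗₁ λ⇐)) ∘ λ⇐)      ≡⟨ cong (swap₁₂ ∘_) assoc ⟩
    swap₁₂ ∘ ((u ⊗₁ (v ⊗₁ t)) ∘ unit³)                  ≡⟨ sym assoc ⟩
    (swap₁₂ ∘ (u ⊗₁ (v ⊗₁ t))) ∘ unit³                  ≡⟨ cong (_∘ unit³) swap₁₂-nat ⟩
    ((v ⊗₁ (u ⊗₁ t)) ∘ swap₁₂) ∘ unit³                  ≡⟨ assoc ⟩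
    (v ⊗₁ (u ⊗₁ t)) ∘ (swap₁₂ ∘ unit³)                  ≡⟨ cong (λ z → (v ⊗₁ (u ⊗₁ t)) ∘ (z ∘ unit³)) swap₁₂-I≡id ⟩
    (v ⊗₁ (u ⊗₁ t)) ∘ (id ∘ unit³)                      ≡⟨ cong ((v ⊗₁ (u ⊗₁ t)) ∘_) identityˡ ⟩
    (v ⊗₁ (u ⊗₁ t)) ∘ unit³                             ≡⟨ sym assoc ⟩
    ((v ⊗₁ (u ⊗₁ t)) ∘ (id ⊗₁ λ⇐)) ∘ λ⇐                 ≡⟨ cong (_∘ λ⇐) (sym ⊗-splitʳ) ⟩
    (v ⊗₁ ((u ⊗₁ t) ∘ λ⇐)) ∘ λ⇐                         ∎
    where
    unit³ : Hom I (I ⊗₀ (I ⊗₀ I))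
    unit³ = (id ⊗₁ λ⇐) ∘ λ⇐

  module _ {B : Obj} (U : Points 𝒞 O B) where

    powP-closed : ∀ n → Closed 𝒞 O (powP 𝒞 O U n)
    powP-closed zero = biorth-closed _
    powP-closed (suc n) = biorth-closed _

    adjSwap-IsTHom : ∀ {n s} → AdjSwap 𝒞 B n s → IsTHom 𝒞 O (powP 𝒞 O U n) (powP 𝒞 O U n) s
    adjSwap-IsTHom (here m) =
      biorth-IsTHom (tensorGenerators U (P (suc m))) (P (2+ m)) (powP-closed (2+ m)) swap₁₂ outer
      where
      P : (k : ℕ) → Points 𝒞 O (_^⊗_ 𝒞 B k)
      P = powP 𝒞 O U
      2+ : ℕ → ℕ
      2+ k = suc (suc k)
      -- The generator u ⊗ w still has w in a biorthogonal, so biorth-IsTHom is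
      -- applied a second time, to swap₁₂ ∘ tensorLeft u on the generators of w.
      outer : ∀ g → tensorGenerators U (P (suc m)) g → P (2+ m) (swap₁₂ ∘ g)
      outer .(u ⊗p w) (u , w , u∈U , w∈P , refl) =
        subst (P (2+ m)) (trans assoc (cong (swap₁₂ ∘_) (tensorLeft-∘ u w)))
          (biorth-IsTHom (tensorGenerators U (P m)) (P (2+ m)) (powP-closed (2+ m))
             (swap₁₂ ∘ tensorLeft u) inner w w∈P)
        where
        inner : ∀ g → tensorGenerators U (P m) g → P (2+ m) ((swap₁₂ ∘ tensorLeft u) ∘ g)
        inner .(v ⊗p t) (v , t , v∈U , t∈P , refl) =
          subst (P (2+ m))
            (sym (trans assoc (trans (cong (swap₁₂ ∘_) (tensorLeft-∘ u (v ⊗p t))) (swap₁₂-⊗p u v t))))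
            (⊆-biorth (v , u ⊗p t , v∈U , ⊆-biorth (u , t , u∈U , t∈P , refl) , refl))
    adjSwap-IsTHom (there {n} {f} a) =
      biorth-IsTHom (tensorGenerators U (powP 𝒞 O U n)) (powP 𝒞 O U (suc n)) (powP-closed (suc n))
        (id ⊗₁ f) gen
      where
      gen : ∀ g → tensorGenerators U (powP 𝒞 O U n) g → powP 𝒞 O U (suc n) ((id ⊗₁ f) ∘ g)
      gen .(u ⊗p v) (u , v , u∈U , v∈P , refl) =
        subst (powP 𝒞 O U (suc n)) (sym (id⊗-∘-⊗p f u v))
          (⊆-biorth (u , f ∘ v , u∈U , adjSwap-IsTHom a v v∈P , refl))

    symmetry-IsTHom : ∀ {n} s → Symmetry 𝒞 B n s → IsTHom 𝒞 O (powP 𝒞 O U n) (powP 𝒞 O U n) s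
    symmetry-IsTHom {n} _ sym-id u u∈P = subst (powP 𝒞 O U n) (sym identityˡ) u∈P
    symmetry-IsTHom {n} _ (sym-step a r) u u∈P =
      subst (powP 𝒞 O U n) (sym assoc) (adjSwap-IsTHom a _ (symmetry-IsTHom _ r u u∈P))

  module _ {B : Obj} {n : ℕ} (E : SymEqualiser 𝒞 B n) where
    open SymEqualiser E

    factorPoints : Points 𝒞 O (_^⊗_ 𝒞 B n) → Points 𝒞 O obj
    factorPoints D k = Σ (Hom I (_^⊗_ 𝒞 B n)) λ h → Σ (EqualisesSyms 𝒞 B n h) λ e →
                         (D h × k ≡ factor h e)

    ∘-equalisesSyms : ∀ {X Y} {h : Hom X (_^⊗_ 𝒞 B n)} (x : Hom Y X) →
                      EqualisesSyms 𝒞 B n h → EqualisesSyms 𝒞 B n (h ∘ x)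
    ∘-equalisesSyms x h-eq s s-sym = trans (sym assoc) (cong (_∘ x) (h-eq s s-sym))

    module _ (D : Points 𝒞 O (_^⊗_ 𝒞 B n)) where

      arr-IsTHom : Closed 𝒞 O D → IsTHom 𝒞 O (biorth 𝒞 O (factorPoints D)) D arr
      arr-IsTHom D-closed = biorth-IsTHom (factorPoints D) D D-closed arr gen
        where
        gen : ∀ g → factorPoints D g → D (arr ∘ g)
        gen .(factor h e) (h , e , h∈D , refl) = subst D (sym (factor-eq h e)) h∈D

      factor-IsTHom : ∀ {X} (Xp : Points 𝒞 O X) (h : Hom X (_^⊗_ 𝒞 B n)) → IsTHom 𝒞 O Xp D h →
                      (e : EqualisesSyms 𝒞 B n h) →
                      IsTHom 𝒞 O Xp (biorth 𝒞 O (factorPoints D)) (factor h e)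
      factor-IsTHom Xp h h-hom e x x∈X =
        ⊆-biorth (h ∘ x , ∘-equalisesSyms x e , h-hom x x∈X ,
                  factor-unique (h ∘ x) (∘-equalisesSyms x e) (factor h e ∘ x)
                    (trans (sym assoc) (cong (_∘ x) (factor-eq h e))))

      factorPoints-isTEqualiser :
        Closed 𝒞 O D → (∀ s → Symmetry 𝒞 B n s → IsTHom 𝒞 O D D s) →
        IsTEqualiser 𝒞 O B n D obj (biorth 𝒞 O (factorPoints D)) arr
      factorPoints-isTEqualiser D-closed syms-hom =
        biorth-closed _ , arr-IsTHom D-closed , syms-hom , equalises ,
        λ X Xp _ h h-hom h-eq →
          factor h h-eq , factor-IsTHom Xp h h-hom h-eq , factor-eq h h-eq ,
          λ k _ arr∘k≡h → factor-unique h h-eq k arr∘k≡h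

mainTheorem11 : {o ℓ : Level} (𝒞 : SymMonCatFP o ℓ) (J : SymMonCatFP.Obj 𝒞)
                (O : ReciprocalOrthogonality 𝒞 J)
                (A : SymMonCatFP.Obj 𝒞) (Ap : Points 𝒞 O A) → Closed 𝒞 O Ap →
                (eqA : (n : ℕ) → SymEqualiser 𝒞 (SymMonCatFP._&_ 𝒞 A (SymMonCatFP.I 𝒞)) n) →
                (n : ℕ) →
                IsTEqualiser 𝒞 O (SymMonCatFP._&_ 𝒞 A (SymMonCatFP.I 𝒞)) n
                  (powP 𝒞 O (_&P_ 𝒞 O Ap (unitP 𝒞 O)) n)
                  (SymEqualiser.obj (eqA n)) (leqP 𝒞 O Ap n (eqA n))
                  (SymEqualiser.arr (eqA n))
mainTheorem11 𝒞 J O A Ap _ eqA n =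
  factorPoints-isTEqualiser (eqA n) (powP 𝒞 O U n) (powP-closed U n) (symmetry-IsTHom U)
  where
  open TensorPowerEqualiser 𝒞 O
  U : Points 𝒞 O (SymMonCatFP._&_ 𝒞 A (SymMonCatFP.I 𝒞))
  U = _&P_ 𝒞 O Ap (unitP 𝒞 O)
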